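{- Let $G_0,G_1\in\mathbb{Z}$, let $(G_n)_{n\in\mathbb{Z}}$ satisfy $G_n=G_{n-1}+G_{n-2}$ for all $n$, and let $m\ge2$. Then for every $n\in\mathbb{Z}$, $m$ divides $\sum_{i=1}^{\pi_{G_0,G_1}(m)}G_{n+i}$.
   Context: The sequence is extended to negative indices by the recurrence. For $m\ge2$, $\pi_{G_0,G_1}(m)$ is the smallest positive integer $r$ with $G_r\equiv G_0\pmod m$ and $G_{r+1}\equiv G_1\pmod m$. -}

module Defs where

open import Data.Nat as ℕ using (ℕ; zero; suc)
open import Data.Integer using (ℤ; +_; _+_; _-_)
open import Data.Integer.Divisibility using (_∣_)
open import Data.Product using (_×_)
open import Relation.Binary.PropositionalEquality using (_≡_)

_≡_[mod_] : ℤ → ℤ → ℕ → Set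
a ≡ b [mod m ] = (+ m) ∣ (a - b)

IsGibonacci : (ℤ → ℤ) → Set
IsGibonacci G = ∀ (n : ℤ) → G n ≡ G (n - + 1) + G (n - + 2)

ReturnsAt : (ℤ → ℤ) → ℕ → ℕ → Set
ReturnsAt G m r =
  (G (+ r) ≡ G (+ 0) [mod m ]) × (G (+ suc r) ≡ G (+ 1) [mod m ])

IsPisanoPeriod : (ℤ → ℤ) → ℕ → ℕ → Set
IsPisanoPeriod G m r =
  (1 ℕ.≤ r) × ReturnsAt G m r × (∀ (s : ℕ) → 1 ℕ.≤ s → ReturnsAt G m s → r ℕ.≤ s)

sumFrom : (ℤ → ℤ) → ℤ → ℕ → ℤ
sumFrom G n zero    = + 0
sumFrom G n (suc r) = sumFrom G n r + G (n + + suc r)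

{-# OPTIONS --safe #-}
-- Since Gibonacci sums telescope, Σ_{i=1}^{r} G(n+i) = G(n+2+r) − G(n+2) = D(n+2), where
-- D k = G(k+r) − G k is again a Gibonacci sequence. That r is a return index says that m
-- divides D 0 and D 1, and a Gibonacci sequence divisible by m at two consecutive indices
-- is divisible by m at every index, in both directions.
module Submission where

open import Defs
open import Data.Nat using (ℕ; _≤_; zero; suc)
import Data.Nat.Properties as ℕ
open import Data.Integer using (ℤ; +_; -[1+_]; _+_; _-_)
open import Data.Integer.Properties using (+-assoc; +-identityʳ; +-inverseʳ)
open import Data.Integer.Divisibility using (_∣_)
open import Data.Integer.Divisibility.Signed as Signed
  using (∣ᵤ⇒∣; ∣⇒∣ᵤ; ∣m∣n⇒∣m+n; ∣m+n∣m⇒∣n)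
open import Data.Integer.Tactic.RingSolver using (solve-∀)
open import Data.Product using (_×_; _,_; proj₁)
open import Relation.Binary.PropositionalEquality
open ≡-Reasoning

gibonacci-step : ∀ {H : ℤ → ℤ} → IsGibonacci H → ∀ k → H (k + + 2) ≡ H (k + + 1) + H k
gibonacci-step {H} gib k = trans (gib (k + + 2)) (cong₂ _+_ (cong H (back₁ k)) (cong H (back₂ k)))
  where
  back₁ : ∀ k → k + + 2 - + 1 ≡ k + + 1
  back₁ = solve-∀
  back₂ : ∀ k → k + + 2 - + 2 ≡ k
  back₂ = solve-∀

sumFrom-telescopes : ∀ {G : ℤ → ℤ} → IsGibonacci G →
  ∀ n r → sumFrom G n r ≡ G (n + + 2 + + r) - G (n + + 2)
sumFrom-telescopes {G} gib n zero rewrite +-identityʳ (n + + 2) = sym (+-inverseʳ (G (n + + 2)))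
sumFrom-telescopes {G} gib n (suc r) = begin
  sumFrom G n r + G (n + + suc r)
    ≡⟨ cong (_+ G (n + + suc r)) (sumFrom-telescopes gib n r) ⟩
  G (n + + 2 + + r) - G (n + + 2) + G (n + + suc r)
    ≡⟨ move-left (G (n + + 2 + + r)) (G (n + + 2)) (G (n + + suc r)) ⟩
  G (n + + 2 + + r) + G (n + + suc r) - G (n + + 2)
    ≡⟨ cong (_- G (n + + 2)) (sym next) ⟩
  G (n + + 2 + + suc r) - G (n + + 2) ∎
  where
  move-left : ∀ a b c → a - b + c ≡ a + c - b
  move-left = solve-∀
  back₁ : ∀ n x → n + + 2 + (+ 1 + x) - + 1 ≡ n + + 2 + x
  back₁ = solve-∀
  back₂ : ∀ n x → n + + 2 + (+ 1 + x) - + 2 ≡ n + (+ 1 + x)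
  back₂ = solve-∀
  next : G (n + + 2 + + suc r) ≡ G (n + + 2 + + r) + G (n + + suc r)
  next = trans (gib (n + + 2 + + suc r))
    (cong₂ _+_ (cong G (back₁ n (+ r))) (cong G (back₂ n (+ r))))

shift-difference : ∀ {G : ℤ → ℤ} → IsGibonacci G → ∀ s → IsGibonacci (λ k → G (k + s) - G k)
shift-difference {G} gib s n = begin
  G (n + s) - G n
    ≡⟨ cong₂ _-_ (gib (n + s)) (gib n) ⟩
  (G (n + s - + 1) + G (n + s - + 2)) - (G (n - + 1) + G (n - + 2))
    ≡⟨ cong₂ (λ i j → (G i + G j) - (G (n - + 1) + G (n - + 2)))
         (shift-before n s (+ 1)) (shift-before n s (+ 2)) ⟩
  (G (n - + 1 + s) + G (n - + 2 + s)) - (G (n - + 1) + G (n - + 2))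
    ≡⟨ interchange (G (n - + 1 + s)) (G (n - + 2 + s)) (G (n - + 1)) (G (n - + 2)) ⟩
  (G (n - + 1 + s) - G (n - + 1)) + (G (n - + 2 + s) - G (n - + 2)) ∎
  where
  shift-before : ∀ n s c → n + s - c ≡ n - c + s
  shift-before = solve-∀
  interchange : ∀ a b c d → (a + b) - (c + d) ≡ (a - c) + (b - d)
  interchange = solve-∀

module _ {H : ℤ → ℤ} (gib : IsGibonacci H) (d : ℤ) where

  private
    DivisibleAt : ℤ → Set
    DivisibleAt k = d Signed.∣ H k

    DivisiblePairAt : ℤ → Set
    DivisiblePairAt k = DivisibleAt k × DivisibleAt (k + + 1)

    pair-suc : ∀ k → DivisiblePairAt k → DivisiblePairAt (k + + 1)
    pair-suc k (d∣Hk , d∣Hk+1) = d∣Hk+1 , d∣Hk+2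
      where
      d∣Hk+2 : DivisibleAt (k + + 1 + + 1)
      d∣Hk+2 rewrite +-assoc k (+ 1) (+ 1) | gibonacci-step gib k = ∣m∣n⇒∣m+n d∣Hk+1 d∣Hk

    pair-pred : ∀ k → DivisiblePairAt (k + + 1) → DivisiblePairAt k
    pair-pred k (d∣Hk+1 , d∣Hk+2) = ∣m+n∣m⇒∣n d∣Hk+1+Hk d∣Hk+1 , d∣Hk+1
      where
      d∣Hk+1+Hk : d Signed.∣ H (k + + 1) + H k
      d∣Hk+1+Hk rewrite sym (gibonacci-step gib k) | sym (+-assoc k (+ 1) (+ 1)) = d∣Hk+2

    pair-everywhere : DivisiblePairAt (+ 0) → ∀ k → DivisiblePairAt k
    pair-everywhere p (+ zero)     = p
    pair-everywhere p (+ suc j)    =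
      subst DivisiblePairAt (cong +_ (ℕ.+-comm j 1)) (pair-suc (+ j) (pair-everywhere p (+ j)))
    pair-everywhere p -[1+ zero ]  = pair-pred -[1+ zero ] p
    pair-everywhere p -[1+ suc j ] = pair-pred -[1+ suc j ] (pair-everywhere p -[1+ j ])

  gibonacci-divisible : d Signed.∣ H (+ 0) → d Signed.∣ H (+ 1) → ∀ k → d Signed.∣ H k
  gibonacci-divisible d∣H0 d∣H1 k = proj₁ (pair-everywhere (d∣H0 , d∣H1) k)

lemma3p8 : (G : ℤ → ℤ) → IsGibonacci G → (m : ℕ) → 2 ≤ m →
    (r : ℕ) → IsPisanoPeriod G m r →
    (n : ℤ) → (+ m) ∣ sumFrom G n r
lemma3p8 G gib m _ r (_ , (returns₀ , returns₁) , _) n =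
  ∣⇒∣ᵤ (subst (+ m Signed.∣_) (sym (sumFrom-telescopes gib n r)) m∣D[n+2])
  where
  m∣D[n+2] : + m Signed.∣ G (n + + 2 + + r) - G (n + + 2)
  m∣D[n+2] = gibonacci-divisible (shift-difference gib (+ r)) (+ m)
    (∣ᵤ⇒∣ returns₀) (∣ᵤ⇒∣ returns₁) (n + + 2)
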